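{- Let $1\le l\le d$. Let $N=\{(a_i^0:\ldots:a_i^d)\}_{1\le i\le m}$ be a cyclic combinatorial $d$-manifold on $n$ vertices. Let $l_i^j\ge 0$ be integers with $\sum_{j=0}^d l_i^j=l$ for each $i$. For $k\ge 0$, let $N_k$ be the union of the difference cycles $(a_i^0+l_i^0k:\ldots:a_i^d+l_i^dk)$, $1\le i\le m$, on $n+lk$ vertices, and assume that every $N_k$, $k\ge 0$, is a combinatorial $d$-manifold. If $l$ is a unit in $\mathbb{Z}_n$, then all but finitely many members of $(N_k)_{k\ge 0}$ are contained in a dense series.
   Context: For positive integers $a_0,\ldots,a_d$ with $M=\sum a_i$, the difference cycle $(a_0:\ldots:a_d)$ on $M$ vertices is the orbit of the simplex $\langle 0,a_0,\ldots,\sum_{i=0}^{d-1}a_i\rangle$ under $v\mapsto v+1\bmod M$ on $\mathbb{Z}_M$. A set of difference cycles denotes their union. A complex is cyclic if it has vertex set $\mathbb{Z}_M$ and is invariant under $v\mapsto v+1\bmod M$. A combinatorial $d$-manifold is a pure $d$-dimensional simplicial complex in which every vertex link is a triangulated $(d-1)$-sphere PL-homeomorphic to the boundary of the $d$-simplex. A dense series (a series of order $1$) is a family $(D_k)_{k\ge0}$ of combinatorial $d$-manifolds of the following kind: there are difference cycles $(b_i^0:\ldots:b_i^d)$, $1\le i\le r$, on $n'$ vertices, and non-negative integers $e_i^j$ with $\sum_j e_i^j=1$ for each $i$, such that $D_k$ is the union of the difference cycles $(b_i^0+e_i^0k:\ldots:b_i^d+e_i^dk)$ on $n'+k$ vertices.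 A complex is contained in a dense series if it is combinatorially isomorphic to a member of it. -}

module Defs where

open import Data.Nat using (ℕ; zero; suc; _+_; _*_; _≤_; _≡ᵇ_; _%_)
open import Data.Bool using (Bool; true; false; if_then_else_; not; _∧_; _∨_)
open import Data.List using (List; []; _∷_; map; concatMap; tabulate; allFin; upTo; length)
open import Data.Nat.ListAction using (sum)
open import Data.List.Membership.Propositional using (_∈_)
open import Data.List.Relation.Unary.Any using (Any)
open import Data.List.Relation.Unary.All using (All)
open import Data.List.Relation.Unary.Unique.Propositional using (Unique)
open import Data.Fin using (Fin)
open import Data.Product using (Σ; _×_; ∃)
open import Relation.Binary.PropositionalEquality using (_≡_; _≢_)
open import Relation.Nullary using (¬_)

-- A simplex is a finite list of vertices (read as its set of elements).
-- A complex is given by a finite list of simplices and stands for the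
-- simplicial complex they generate (all subsets of listed simplices).

Simplex : Set
Simplex = List ℕ

Complex : Set
Complex = List Simplex

IsFace : Simplex → Complex → Set
IsFace σ K = Any (λ F → ∀ v → v ∈ σ → v ∈ F) K

Vert : ℕ → Complex → Set
Vert v K = Any (v ∈_) K

SameCx : Complex → Complex → Set
SameCx K L = ∀ σ → (IsFace σ K → IsFace σ L) × (IsFace σ L → IsFace σ K)

Iso : Complex → Complex → Set
Iso K L = Σ (ℕ → ℕ) λ f →
  (∀ u v → Vert u K → Vert v K → f u ≡ f v → u ≡ v) ×
  SameCx (map (map f) K) L

memb : ℕ → List ℕ → Bool
memb v []       = false
memb v (u ∷ us) = (u ≡ᵇ v) ∨ memb v us

subB : List ℕ → List ℕ → Bool
subB []       F = true
subB (v ∷ vs) F = memb v F ∧ subB vs F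

removeV : ℕ → List ℕ → List ℕ
removeV v []       = []
removeV v (u ∷ us) = if u ≡ᵇ v then removeV v us else u ∷ removeV v us

-- stellar subdivision of K at the face σ with a new vertex w:
-- every simplex F ⊇ σ is replaced by the simplices w ∪ (F ∖ {v}), v ∈ σ
-- (i.e. star(σ) is replaced by w * ∂σ * lk(σ)).
stellar : Complex → Simplex → ℕ → Complex
stellar K σ w = concatMap step K
  where
  step : Simplex → Complex
  step F = if subB σ F then map (λ v → w ∷ removeV v F) σ else (F ∷ [])

StellarStep : Complex → Complex → Set
StellarStep K L = Σ Simplex λ σ → Σ ℕ λ w →
  (σ ≢ []) × Unique σ × IsFace σ K × (¬ Vert w K) × SameCx L (stellar K σ w)

-- For finite complexes this is exactly
-- PL-homeomorphism (Newman's theorem).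
data PLHomeo : Complex → Complex → Set where
  iso   : ∀ {K L} → Iso K L → PLHomeo K L
  sub   : ∀ {K L} → StellarStep K L → PLHomeo K L
  weld  : ∀ {K L} → StellarStep L K → PLHomeo K L
  trans : ∀ {K L M} → PLHomeo K L → PLHomeo L M → PLHomeo K M

bdSimplex : ℕ → Complex
bdSimplex d = map (λ i → removeV i (upTo (suc d))) (upTo (suc d))

-- link of a vertex (for a complex given by its facets)
link : ℕ → Complex → Complex
link v K = concatMap (λ F → if memb v F then removeV v F ∷ [] else []) K

Pure : ℕ → Complex → Set
Pure d K = (K ≢ []) × All (λ F → Unique F × length F ≡ suc d) K

CombManifold : ℕ → Complex → Set
CombManifold d K = Pure d K × (∀ v → Vert v K → PLHomeo (link v K) (bdSimplex d))

modN : ℕ → ℕ → ℕ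
modN x zero    = x
modN x (suc m) = x % suc m

psums : List ℕ → List ℕ
psums []       = []
psums (g ∷ gs) = 0 ∷ map (g +_) (psums gs)

diffCycle : ℕ → List ℕ → Complex
diffCycle M gs = map (λ v → map (λ s → modN (v + s) M) (psums gs)) (upTo M)

cycles : ℕ → (r : ℕ) → (Fin r → List ℕ) → Complex
cycles M r g = concatMap (λ i → diffCycle M (g i)) (allFin r)

series : (d n l m : ℕ) → (Fin m → Fin (suc d) → ℕ) → (Fin m → Fin (suc d) → ℕ) → ℕ → Complex
series d n l m a e k = cycles (n + l * k) m (λ i → tabulate (λ j → a i j + e i j * k))

record DenseSeries (d : ℕ) : Set where
  field
    n'   : ℕ
    r    : ℕ
    b    : Fin r → Fin (suc d) → ℕ
    e    : Fin r → Fin (suc d) → ℕ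
    bpos : ∀ i j → 1 ≤ b i j
    bsum : ∀ i → sum (tabulate (b i)) ≡ n'
    esum : ∀ i → sum (tabulate (e i)) ≡ 1
    mfd  : ∀ k → CombManifold d (series d n' 1 r b e k)

  member : ℕ → Complex
  member k = series d n' 1 r b e k

ContainedInDense : ℕ → Complex → Set
ContainedInDense d K = Σ (DenseSeries d) λ D → ∃ λ k → Iso K (DenseSeries.member D k)

UnitMod : ℕ → ℕ → Set
UnitMod l n = ∃ λ x → ∃ λ y → l * x ≡ 1 + y * n

-- Multiplication by l is a bijection of ℤ_{n+lk} (l is a unit mod n, hence mod n + lk).
-- It sends the facet of (a^0 + l^0 k : … : a^d + l^d k) based at v, whose vertices are
-- v + A_j + C_j k with A_j, C_j the partial sums of the a^t and l^t, to the translate by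
-- l v + l² k of the set {l A_j + (l - C_j) n}, which does not depend on k.  Listing this
-- set as z_0 < … < z_d, N_k is isomorphic to the union of the difference cycles
-- (z_1 - z_0 : … : z_d - z_{d-1} : rest) on n + l k vertices: all gaps but the last are
-- fixed, so N_k is a member D_j of a dense series.  The other members are manifolds too
-- once they have more than 2S vertices, S ≥ z_d: the link of a vertex only sees the
-- vertices within distance S of it, and these look the same in D_j as in a larger N_k.

module Submission where

open import Defs hiding (iso; sub; weld; trans)
open import Data.Bool using (true; false; if_then_else_; T)
open import Data.Empty using (⊥-elim)
open import Data.Fin using (Fin; toℕ) renaming (zero to fzero; suc to fsuc)
open import Data.List using (List; []; _∷_; map; tabulate; length; concat; allFin)
open import Data.List.Membership.Propositional using (_∈_; find; lose)
open import Data.List.Membership.Propositional.Properties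
  using (∈-map⁺; ∈-map⁻; ∈-concat⁺; ∈-concat⁻; ∈-concat⁺′; ∈-concat⁻′; ∈-upTo⁺; ∈-upTo⁻; ∈-allFin; ∈-tabulate⁺)
open import Data.List.Properties using (map-∘; map-cong; map-cong-local; length-map; length-tabulate)
open import Data.List.Relation.Binary.Permutation.Propositional using (↭-sym; ↭⇒↭ₛ)
open import Data.List.Relation.Binary.Permutation.Propositional.Properties using (∈-resp-↭; ↭-length)
open import Data.List.Relation.Unary.All as All using (All; []; _∷_)
open import Data.List.Relation.Unary.AllPairs as AllPairs using ([]; _∷_)
open import Data.List.Relation.Unary.Any using (here; there)
open import Data.List.Relation.Unary.Linked using (Linked; []; [-]; _∷_)
open import Data.List.Relation.Unary.Linked.Properties using (Linked⇒AllPairs)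
open import Data.List.Relation.Unary.Unique.Propositional using (Unique)
open import Data.List.Relation.Unary.Unique.Propositional.Properties using () renaming (map⁻ to Unique-map⁻)
open import Data.Nat using (ℕ; zero; suc; _+_; _*_; _∸_; _≤_; _<_; _%_; _≡ᵇ_; _<?_; z≤n; s≤s)
open import Data.Nat.DivMod
open import Data.Nat.ListAction using (sum)
open import Data.Nat.Properties
open import Data.Nat.Tactic.RingSolver using (solve-∀)
open import Data.Product using (_×_; ∃; _,_; proj₁; proj₂)
open import Data.Sum using (_⊎_; inj₁; inj₂)
open import Data.Unit using (tt)
open import Function using (_∘_)
open import Relation.Binary.PropositionalEquality
  using (_≡_; _≢_; refl; sym; trans; cong; cong₂; subst; setoid; module ≡-Reasoning)
open import Relation.Nullary using (yes; no)

import Data.List.Relation.Binary.Permutation.Setoid.Properties (setoid ℕ) as Perm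
open import Data.List.Sort ≤-decTotalOrder using (sort; sort-↭; sort-↗)

_⊆_ : List ℕ → List ℕ → Set
xs ⊆ ys = ∀ v → v ∈ xs → v ∈ ys

≡ᵇ-refl : ∀ v → (v ≡ᵇ v) ≡ true
≡ᵇ-refl zero    = refl
≡ᵇ-refl (suc v) = ≡ᵇ-refl v

≡ᵇ-true : ∀ {u v} → (u ≡ᵇ v) ≡ true → u ≡ v
≡ᵇ-true {u} {v} eq = ≡ᵇ⇒≡ u v (subst T (sym eq) tt)

≡ᵇ-false : ∀ {u v} → (u ≡ᵇ v) ≡ false → u ≢ v
≡ᵇ-false {u} eq refl = subst T eq (≡⇒≡ᵇ u u refl)

memb⇒∈ : ∀ v F → memb v F ≡ true → v ∈ F
memb⇒∈ v (u ∷ us) h with u ≡ᵇ v in eq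
... | true  = here (sym (≡ᵇ-true eq))
... | false = there (memb⇒∈ v us h)

∈⇒memb : ∀ v F → v ∈ F → memb v F ≡ true
∈⇒memb v (u ∷ us) (here refl) rewrite ≡ᵇ-refl v = refl
∈⇒memb v (u ∷ us) (there p) with u ≡ᵇ v
... | true  = refl
... | false = ∈⇒memb v us p

∈-removeV⁻ : ∀ v F {x} → x ∈ removeV v F → x ∈ F × x ≢ v
∈-removeV⁻ v (u ∷ us) p with u ≡ᵇ v in eq
... | true = let x∈us , x≢v = ∈-removeV⁻ v us p in there x∈us , x≢v
∈-removeV⁻ v (u ∷ us) (here refl) | false = here refl , ≡ᵇ-false eq
∈-removeV⁻ v (u ∷ us) (there p)   | false = let x∈us , x≢v = ∈-removeV⁻ v us p in there x∈us , x≢v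

∈-removeV⁺ : ∀ v F {x} → x ∈ F → x ≢ v → x ∈ removeV v F
∈-removeV⁺ v (u ∷ us) (here refl) x≢v with u ≡ᵇ v in eq
... | true  = ⊥-elim (x≢v (≡ᵇ-true eq))
... | false = here refl
∈-removeV⁺ v (u ∷ us) (there p) x≢v with u ≡ᵇ v
... | true  = ∈-removeV⁺ v us p x≢v
... | false = there (∈-removeV⁺ v us p x≢v)

∈-link⁻ : ∀ v K {G} → G ∈ link v K → ∃ λ F → F ∈ K × v ∈ F × G ≡ removeV v F
∈-link⁻ v (F ∷ K) p with memb v F in eq
∈-link⁻ v (F ∷ K) (here G≡) | true = F , here refl , memb⇒∈ v F eq , G≡
∈-link⁻ v (F ∷ K) (there p) | true =
  let F' , F'∈K , v∈F' , G≡ = ∈-link⁻ v K p in F' , there F'∈K , v∈F' , G≡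
∈-link⁻ v (F ∷ K) p | false =
  let F' , F'∈K , v∈F' , G≡ = ∈-link⁻ v K p in F' , there F'∈K , v∈F' , G≡

∈-link⁺ : ∀ v K {F} → F ∈ K → v ∈ F → removeV v F ∈ link v K
∈-link⁺ v (F ∷ K) (here refl) v∈F rewrite ∈⇒memb v F v∈F = here refl
∈-link⁺ v (F' ∷ K) (there p) v∈F with memb v F'
... | true  = there (∈-link⁺ v K p v∈F)
... | false = ∈-link⁺ v K p v∈F

singleton-⊆ : ∀ {x σ} → x ∈ σ → (x ∷ []) ⊆ σ
singleton-⊆ x∈σ v (here refl) = x∈σ

mutual-cover⇒SameCx : ∀ A B →
  (∀ {F} → F ∈ A → ∃ λ G → G ∈ B × F ⊆ G) →
  (∀ {G} → G ∈ B → ∃ λ F → F ∈ A × G ⊆ F) → SameCx A B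
mutual-cover⇒SameCx A B A⊑B B⊑A σ = to , from
  where
  to : IsFace σ A → IsFace σ B
  to p = let F , F∈A , σ⊆F = find p ; G , G∈B , F⊆G = A⊑B F∈A
         in lose G∈B (λ v v∈σ → F⊆G v (σ⊆F v v∈σ))
  from : IsFace σ B → IsFace σ A
  from p = let G , G∈B , σ⊆G = find p ; F , F∈A , G⊆F = B⊑A G∈B
           in lose F∈A (λ v v∈σ → G⊆F v (σ⊆G v v∈σ))

Iso-vert⁻ : ∀ K L (f : ℕ → ℕ) → SameCx (map (map f) K) L → ∀ {y} → Vert y L →
  ∃ λ u → Vert u K × f u ≡ y
Iso-vert⁻ K L f same {y} y∈L =
  let H , H∈L , y∈H = find y∈L
      G , G∈fK , y⊆G = find (proj₂ (same (y ∷ [])) (lose H∈L (singleton-⊆ y∈H)))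
      F , F∈K , G≡ = ∈-map⁻ (map f) G∈fK
      u , u∈F , y≡fu = ∈-map⁻ f (subst (y ∈_) G≡ (y⊆G y (here refl)))
  in u , lose F∈K u∈F , sym y≡fu

Iso-vert : ∀ K L → ((f , _) : Iso K L) → ∀ {v} → Vert v K → Vert (f v) L
Iso-vert K L (f , _ , same) {v} v∈K =
  let F , F∈K , v∈F = find v∈K
      H , H∈L , fv⊆H = find (proj₁ (same (f v ∷ [])) (lose (∈-map⁺ (map f) F∈K) (singleton-⊆ (∈-map⁺ f v∈F))))
  in lose H∈L (fv⊆H _ (here refl))

Vert-link⇒Vert : ∀ v K {u} → Vert u (link v K) → Vert u K
Vert-link⇒Vert v K u∈lk =
  let G , G∈lk , u∈G = find u∈lk
      F , F∈K , _ , G≡ = ∈-link⁻ v K G∈lk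
  in lose F∈K (proj₁ (∈-removeV⁻ v F (subst (_ ∈_) G≡ u∈G)))

Iso-link : ∀ K L → ((f , _) : Iso K L) → ∀ {v} → Vert v K → Iso (link v K) (link (f v) L)
Iso-link K L (f , inj , same) {v} v∈K = f , inj-lk , λ σ → to σ , from σ
  where
  inj-lk : ∀ u w → Vert u (link v K) → Vert w (link v K) → f u ≡ f w → u ≡ w
  inj-lk u w u∈ w∈ = inj u w (Vert-link⇒Vert v K u∈) (Vert-link⇒Vert v K w∈)
  cone-⊆ : ∀ {σ F} → σ ⊆ map f (removeV v F) → v ∈ F → (f v ∷ σ) ⊆ map f F
  cone-⊆ σ⊆ v∈F _ (here refl) = ∈-map⁺ f v∈F
  cone-⊆ {F = F} σ⊆ v∈F x (there x∈σ) =
    let u , u∈ , x≡fu = ∈-map⁻ f (σ⊆ x x∈σ)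
    in subst (_∈ map f F) (sym x≡fu) (∈-map⁺ f (proj₁ (∈-removeV⁻ v F u∈)))
  ≢fv : ∀ {σ F x} → σ ⊆ map f (removeV v F) → F ∈ K → x ∈ σ → x ≢ f v
  ≢fv {F = F} σ⊆ F∈K x∈σ x≡fv =
    let u , u∈ , x≡fu = ∈-map⁻ f (σ⊆ _ x∈σ)
        u∈F , u≢v = ∈-removeV⁻ v F u∈
    in u≢v (inj _ v (lose F∈K u∈F) v∈K (trans (sym x≡fu) x≡fv))
  to : ∀ σ → IsFace σ (map (map f) (link v K)) → IsFace σ (link (f v) L)
  to σ p with find p
  ... | _ , G'∈ , σ⊆ with ∈-map⁻ (map f) G'∈
  ... | G , G∈lk , refl with ∈-link⁻ v K G∈lk
  ... | F , F∈K , v∈F , refl with find (proj₁ (same (f v ∷ σ)) (lose (∈-map⁺ (map f) F∈K) (cone-⊆ σ⊆ v∈F)))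
  ... | H , H∈L , fvσ⊆H =
    lose (∈-link⁺ (f v) L H∈L (fvσ⊆H _ (here refl)))
         (λ x x∈σ → ∈-removeV⁺ (f v) H (fvσ⊆H x (there x∈σ)) (≢fv σ⊆ F∈K x∈σ))
  from : ∀ σ → IsFace σ (link (f v) L) → IsFace σ (map (map f) (link v K))
  from σ p with find p
  ... | _ , G∈lk , σ⊆ with ∈-link⁻ (f v) L G∈lk
  ... | H , H∈L , fv∈H , refl with find (proj₂ (same H) (lose H∈L (λ _ x∈ → x∈)))
  ... | _ , G'∈ , H⊆ with ∈-map⁻ (map f) G'∈
  ... | F , F∈K , refl with ∈-map⁻ f (H⊆ _ fv∈H)
  ... | u , u∈F , fv≡fu with inj u v (lose F∈K u∈F) v∈K (sym fv≡fu)
  ... | refl = lose (∈-map⁺ (map f) (∈-link⁺ v K F∈K u∈F)) σ⊆fF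
    where
    σ⊆fF : σ ⊆ map f (removeV v F)
    σ⊆fF x x∈σ =
      let x∈H , x≢fv = ∈-removeV⁻ (f v) H (σ⊆ x x∈σ)
          u' , u'∈F , x≡fu' = ∈-map⁻ f (H⊆ x x∈H)
      in subst (_∈ map f (removeV v F)) (sym x≡fu')
           (∈-map⁺ f (∈-removeV⁺ v F u'∈F (λ u'≡v → x≢fv (trans x≡fu' (cong f u'≡v)))))

-- junk value 0 when y has no preimage in the list
preimage : (ℕ → ℕ) → List ℕ → ℕ → ℕ
preimage f []       y = 0
preimage f (u ∷ us) y = if f u ≡ᵇ y then u else preimage f us y

preimage-spec : ∀ f us {y u} → u ∈ us → f u ≡ y → preimage f us y ∈ us × f (preimage f us y) ≡ y
preimage-spec f (w ∷ us) {y} u∈ fu≡y with f w ≡ᵇ y in eq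
... | true = here refl , ≡ᵇ-true eq
preimage-spec f (w ∷ us) (here refl) fu≡y | false = ⊥-elim (≡ᵇ-false eq fu≡y)
preimage-spec f (w ∷ us) (there u∈) fu≡y  | false =
  let p∈ , fp≡y = preimage-spec f us u∈ fu≡y in there p∈ , fp≡y

Iso-sym : ∀ K L → Iso K L → Iso L K
Iso-sym K L (f , inj , same) = g , inj-g , λ σ → to σ , from σ
  where
  g : ℕ → ℕ
  g = preimage f (concat K)
  g∘f : ∀ {u} → Vert u K → g (f u) ≡ u
  g∘f {u} u∈K = let p∈ , fp≡fu = preimage-spec f (concat K) (∈-concat⁺ u∈K) refl
                in inj _ u (∈-concat⁻ K p∈) u∈K fp≡fu
  inj-g : ∀ y₁ y₂ → Vert y₁ L → Vert y₂ L → g y₁ ≡ g y₂ → y₁ ≡ y₂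
  inj-g y₁ y₂ y₁∈ y₂∈ gy≡ with Iso-vert⁻ K L f same y₁∈ | Iso-vert⁻ K L f same y₂∈
  ... | u₁ , u₁∈ , refl | u₂ , u₂∈ , refl = cong f (trans (sym (g∘f u₁∈)) (trans gy≡ (g∘f u₂∈)))
  to : ∀ σ → IsFace σ (map (map g) L) → IsFace σ K
  to σ p with find p
  ... | _ , G'∈ , σ⊆ with ∈-map⁻ (map g) G'∈
  ... | H , H∈L , refl with find (proj₂ (same H) (lose H∈L (λ _ x∈ → x∈)))
  ... | _ , G∈ , H⊆ with ∈-map⁻ (map f) G∈
  ... | F , F∈K , refl = lose F∈K σ⊆F
    where
    σ⊆F : σ ⊆ F
    σ⊆F x x∈σ =
      let y , y∈H , x≡gy = ∈-map⁻ g (σ⊆ x x∈σ)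
          u , u∈F , y≡fu = ∈-map⁻ f (H⊆ y y∈H)
      in subst (_∈ F) (sym (trans x≡gy (trans (cong g y≡fu) (g∘f (lose F∈K u∈F))))) u∈F
  from : ∀ σ → IsFace σ K → IsFace σ (map (map g) L)
  from σ p with find p
  ... | F , F∈K , σ⊆F with find (proj₁ (same (map f F)) (lose (∈-map⁺ (map f) F∈K) (λ _ x∈ → x∈)))
  ... | H , H∈L , fF⊆H = lose (∈-map⁺ (map g) H∈L) σ⊆gH
    where
    σ⊆gH : σ ⊆ map g H
    σ⊆gH x x∈σ = subst (_∈ map g H) (g∘f (lose F∈K (σ⊆F x x∈σ)))
                   (∈-map⁺ g (fF⊆H (f x) (∈-map⁺ f (σ⊆F x x∈σ))))

local-bijection⇒Iso-link : ∀ K K' {v v'} (h : ℕ → ℕ) → h v ≡ v' →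
  (∀ x y → h x ≡ h y → x ≡ y) →
  (∀ {F} → F ∈ K → v ∈ F → map h F ∈ K') →
  (∀ {F'} → F' ∈ K' → v' ∈ F' → ∃ λ F → F ∈ K × v ∈ F × map h F ≡ F') →
  Iso (link v K) (link v' K')
local-bijection⇒Iso-link K K' {v} {v'} h hv≡v' inj fwd bwd =
  h , (λ x y _ _ → inj x y) , mutual-cover⇒SameCx _ _ cover₁ cover₂
  where
  cover₁ : ∀ {G} → G ∈ map (map h) (link v K) → ∃ λ G' → G' ∈ link v' K' × G ⊆ G'
  cover₁ G∈ with ∈-map⁻ (map h) G∈
  ... | G₀ , G₀∈ , refl with ∈-link⁻ v K G₀∈
  ... | F , F∈K , v∈F , refl =
    removeV v' (map h F) , ∈-link⁺ v' K' (fwd F∈K v∈F) (subst (_∈ map h F) hv≡v' (∈-map⁺ h v∈F)) , sub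
    where
    sub : map h (removeV v F) ⊆ removeV v' (map h F)
    sub x x∈ with ∈-map⁻ h x∈
    ... | u , u∈ , refl with ∈-removeV⁻ v F u∈
    ... | u∈F , u≢v = ∈-removeV⁺ v' (map h F) (∈-map⁺ h u∈F) (λ e → u≢v (inj u v (trans e (sym hv≡v'))))
  cover₂ : ∀ {G'} → G' ∈ link v' K' → ∃ λ G → G ∈ map (map h) (link v K) × G' ⊆ G
  cover₂ G'∈ with ∈-link⁻ v' K' G'∈
  ... | F' , F'∈K' , v'∈F' , refl with bwd F'∈K' v'∈F'
  ... | F , F∈K , v∈F , refl = map h (removeV v F) , ∈-map⁺ (map h) (∈-link⁺ v K F∈K v∈F) , sub
    where
    sub : removeV v' (map h F) ⊆ map h (removeV v F)
    sub x x∈ with ∈-removeV⁻ v' (map h F) x∈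
    ... | x∈hF , x≢v' with ∈-map⁻ h x∈hF
    ... | u , u∈F , refl = ∈-map⁺ h (∈-removeV⁺ v F u∈F (λ e → x≢v' (trans (cong h e) hv≡v')))

-- Arithmetic modulo M

[1+y*m]*c≡c+y*c*m : ∀ y m c → (1 + y * m) * c ≡ c + y * c * m
[1+y*m]*c≡c+y*c*m = solve-∀

module Modulo (M-1 : ℕ) where

  M : ℕ
  M = suc M-1

  infix 4 _≋_
  record _≋_ (x y : ℕ) : Set where
    constructor mk
    field un : x % M ≡ y % M
  open _≋_ public

  ≋-refl : ∀ {x} → x ≋ x
  ≋-refl = mk refl

  ≋-sym : ∀ {x y} → x ≋ y → y ≋ x
  ≋-sym (mk p) = mk (sym p)

  ≋-trans : ∀ {x y z} → x ≋ y → y ≋ z → x ≋ z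
  ≋-trans (mk p) (mk q) = mk (trans p q)

  ≡⇒≋ : ∀ {x y} → x ≡ y → x ≋ y
  ≡⇒≋ refl = ≋-refl

  %-≋ : ∀ x → x % M ≋ x
  %-≋ x = mk (m%n%n≡m%n x M)

  +-≋ : ∀ {a b c d} → a ≋ b → c ≋ d → a + c ≋ b + d
  +-≋ {a} {b} {c} {d} (mk a≋b) (mk c≋d) = mk (begin
    (a + c) % M           ≡⟨ %-distribˡ-+ a c M ⟩
    (a % M + c % M) % M   ≡⟨ cong₂ (λ x y → (x + y) % M) a≋b c≋d ⟩
    (b % M + d % M) % M   ≡⟨ %-distribˡ-+ b d M ⟨
    (b + d) % M           ∎)
    where open ≡-Reasoning

  *-≋ : ∀ {a b c d} → a ≋ b → c ≋ d → a * c ≋ b * d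
  *-≋ {a} {b} {c} {d} (mk a≋b) (mk c≋d) = mk (begin
    (a * c) % M           ≡⟨ %-distribˡ-* a c M ⟩
    (a % M * (c % M)) % M ≡⟨ cong₂ (λ x y → (x * y) % M) a≋b c≋d ⟩
    (b % M * (d % M)) % M ≡⟨ %-distribˡ-* b d M ⟨
    (b * d) % M           ∎)
    where open ≡-Reasoning

  +kM-≋ : ∀ x k → x + k * M ≋ x
  +kM-≋ x k = mk ([m+kn]%n≡m%n x k M)

  ≋⇒% : ∀ {x y} → y < M → x ≋ y → x % M ≡ y
  ≋⇒% {y = y} y<M (mk e) = trans e (m<n⇒m%n≡m y<M)

  ≋⇒≡ : ∀ {x y} → x < M → y < M → x ≋ y → x ≡ y
  ≋⇒≡ {x} x<M y<M x≋y = trans (sym (m<n⇒m%n≡m x<M)) (≋⇒% y<M x≋y)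

  -- lies in [1, M]: neg 0 is M, not 0
  neg : ℕ → ℕ
  neg w = M ∸ w % M

  +-neg : ∀ w → w + neg w ≋ 0
  +-neg w = ≋-trans (+-≋ (≋-sym (%-≋ w)) (≋-refl {neg w}))
              (≋-trans (≡⇒≋ (m+[n∸m]≡n (<⇒≤ (m%n<n w M)))) (mk (n%n≡0 M)))

  +-cancelˡ-≋ : ∀ w {a b} → w + a ≋ w + b → a ≋ b
  +-cancelˡ-≋ w {a} {b} e =
    ≋-trans (≋-sym (cancel a)) (≋-trans (+-≋ (≋-refl {neg w}) e) (cancel b))
    where
    cancel : ∀ c → neg w + (w + c) ≋ c
    cancel c = ≋-trans (≡⇒≋ (sym (+-assoc (neg w) w c)))
                 (≋-trans (+-≋ (≋-trans (≡⇒≋ (+-comm (neg w) w)) (+-neg w)) (≋-refl {c})) ≋-refl)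

  translate-injective : ∀ w {a b} → a < M → b < M → (w + a) % M ≡ (w + b) % M → a ≡ b
  translate-injective w a<M b<M e = ≋⇒≡ a<M b<M (+-cancelˡ-≋ w (mk e))

  module Unit {l x y : ℕ} (l*x≡1 : l * x ≡ 1 + y * M) where

    *-inverseʳ : ∀ c → l * (x * c) ≋ c
    *-inverseʳ c = ≋-trans (≡⇒≋ (trans (sym (*-assoc l x c)) (cong (_* c) l*x≡1)))
                     (≋-trans (≡⇒≋ ([1+y*m]*c≡c+y*c*m y M c)) (+kM-≋ c (y * c)))

    *-inverseˡ : ∀ c → x * (l * c) ≋ c
    *-inverseˡ c = ≋-trans (≡⇒≋ x*[l*c]≡l*[x*c]) (*-inverseʳ c)
      where
      x*[l*c]≡l*[x*c] : x * (l * c) ≡ l * (x * c)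
      x*[l*c]≡l*[x*c] = trans (sym (*-assoc x l c)) (trans (cong (_* c) (*-comm x l)) (*-assoc l x c))

    *-injective : ∀ {a b} → a < M → b < M → (l * a) % M ≡ (l * b) % M → a ≡ b
    *-injective {a} {b} a<M b<M e =
      ≋⇒≡ a<M b<M (≋-trans (≋-sym (*-inverseˡ a)) (≋-trans (*-≋ (≋-refl {x}) (mk e)) (*-inverseˡ b)))

-- Unions of difference cycles

Unique-map⁺-local : ∀ (f : ℕ → ℕ) {xs} → (∀ {x y} → x ∈ xs → y ∈ xs → f x ≡ f y → x ≡ y) →
  Unique xs → Unique (map f xs)
Unique-map⁺-local f {[]}     inj []         = []
Unique-map⁺-local f {x ∷ xs} inj (x∉ ∷ xs!) =
  All.tabulate fx∉ ∷ Unique-map⁺-local f (λ x∈ y∈ → inj (there x∈) (there y∈)) xs!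
  where
  fx∉ : ∀ {y} → y ∈ map f xs → f x ≢ y
  fx∉ y∈ fx≡y with ∈-map⁻ f y∈
  ... | z , z∈ , refl = All.lookup x∉ z∈ (inj (here refl) (there z∈) fx≡y)

translate : ℕ → List ℕ → ℕ → List ℕ
translate M-1 P w = map (λ s → modN (w + s) (suc M-1)) P

∈-cycles⁻ : ∀ M-1 r (g : Fin r → List ℕ) {F} → F ∈ cycles (suc M-1) r g →
  ∃ λ i → ∃ λ w → w < suc M-1 × F ≡ translate M-1 (psums (g i)) w
∈-cycles⁻ M-1 r g F∈ with ∈-concat⁻′ (map (λ i → diffCycle (suc M-1) (g i)) (allFin r)) F∈
... | _ , F∈C , C∈ with ∈-map⁻ (λ i → diffCycle (suc M-1) (g i)) C∈
... | i , _ , refl with ∈-map⁻ (translate M-1 (psums (g i))) F∈C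
... | w , w∈ , refl = i , w , ∈-upTo⁻ w∈ , refl

∈-cycles⁺ : ∀ M-1 r (g : Fin r → List ℕ) i {w} → w < suc M-1 →
  translate M-1 (psums (g i)) w ∈ cycles (suc M-1) r g
∈-cycles⁺ M-1 r g i w<M = ∈-concat⁺′ (∈-map⁺ (translate M-1 (psums (g i))) (∈-upTo⁺ w<M))
                                     (∈-map⁺ (λ i → diffCycle (suc M-1) (g i)) (∈-allFin i))

translate-< : ∀ M-1 P w {u} → u ∈ translate M-1 P w → u < suc M-1
translate-< M-1 P w u∈ with ∈-map⁻ (λ s → modN (w + s) (suc M-1)) u∈
... | s , _ , refl = m%n<n (w + s) (suc M-1)

Vert-cycles-< : ∀ M-1 r (g : Fin r → List ℕ) {u} → Vert u (cycles (suc M-1) r g) → u < suc M-1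
Vert-cycles-< M-1 r g u∈ with find u∈
... | F , F∈ , u∈F with ∈-cycles⁻ M-1 r g F∈
... | i , w , _ , refl = translate-< M-1 _ w u∈F

cycles-Iso : ∀ M₁-1 M₂-1 r (g₁ g₂ : Fin r → List ℕ) (h : ℕ → ℕ) (φ : Fin r → ℕ → ℕ) →
  (∀ {u v} → u < suc M₁-1 → v < suc M₁-1 → h u ≡ h v → u ≡ v) →
  (∀ i {w} → w < suc M₁-1 → φ i w < suc M₂-1) →
  (∀ i {w} → w < suc M₁-1 → map h (translate M₁-1 (psums (g₁ i)) w) ⊆ translate M₂-1 (psums (g₂ i)) (φ i w)) →
  (∀ i {w} → w < suc M₁-1 → translate M₂-1 (psums (g₂ i)) (φ i w) ⊆ map h (translate M₁-1 (psums (g₁ i)) w)) →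
  (∀ i {w'} → w' < suc M₂-1 → ∃ λ w → w < suc M₁-1 × φ i w ≡ w') →
  Iso (cycles (suc M₁-1) r g₁) (cycles (suc M₂-1) r g₂)
cycles-Iso M₁-1 M₂-1 r g₁ g₂ h φ inj φ< fwd bwd surj =
  h , (λ u v u∈ v∈ → inj (Vert-cycles-< M₁-1 r g₁ u∈) (Vert-cycles-< M₁-1 r g₁ v∈)) ,
  mutual-cover⇒SameCx _ _ cover₁ cover₂
  where
  cover₁ : ∀ {F} → F ∈ map (map h) (cycles (suc M₁-1) r g₁) → ∃ λ G → G ∈ cycles (suc M₂-1) r g₂ × F ⊆ G
  cover₁ F∈ with ∈-map⁻ (map h) F∈
  ... | F₀ , F₀∈ , refl with ∈-cycles⁻ M₁-1 r g₁ F₀∈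
  ... | i , w , w< , refl = _ , ∈-cycles⁺ M₂-1 r g₂ i (φ< i w<) , fwd i w<
  cover₂ : ∀ {G} → G ∈ cycles (suc M₂-1) r g₂ → ∃ λ F → F ∈ map (map h) (cycles (suc M₁-1) r g₁) × G ⊆ F
  cover₂ G∈ with ∈-cycles⁻ M₂-1 r g₂ G∈
  ... | i , w' , w'< , refl with surj i w'<
  ... | w , w< , refl = _ , ∈-map⁺ (map h) (∈-cycles⁺ M₁-1 r g₁ i w<) , bwd i w<

module Rotation (M-1 : ℕ) where
  open Modulo M-1

  rotate : ℕ → ℕ → ℕ
  rotate c x = (c + x) % M

  rotate-translate : ∀ c P w → map (rotate c) (translate M-1 P w) ≡ translate M-1 P (rotate c w)
  rotate-translate c P w = trans (sym (map-∘ P)) (map-cong-local (All.tabulate λ {s} _ →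
    un (≋-trans (+-≋ (≋-refl {c}) (%-≋ (w + s)))
       (≋-trans (≡⇒≋ (sym (+-assoc c w s))) (+-≋ (≋-sym (%-≋ (c + w))) (≋-refl {s}))))))

  rotate-neg : ∀ v → rotate (neg v) v ≡ 0
  rotate-neg v = ≋⇒% (s≤s z≤n) (≋-trans (≡⇒≋ (+-comm (neg v) v)) (+-neg v))

  cycles-rotate-Iso : ∀ r (g : Fin r → List ℕ) c → Iso (cycles M r g) (cycles M r g)
  cycles-rotate-Iso r g c = cycles-Iso M-1 M-1 r g g (rotate c) (λ _ → rotate c)
    (translate-injective c) (λ _ {w} _ → m%n<n (c + w) M)
    (λ i {w} _ x x∈ → subst (x ∈_) (rotate-translate c (psums (g i)) w) x∈)
    (λ i {w} _ x x∈ → subst (x ∈_) (sym (rotate-translate c (psums (g i)) w)) x∈)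
    (λ _ {w'} w'<M → (neg c + w') % M , m%n<n (neg c + w') M , ≋⇒% w'<M (back w'))
    where
    back : ∀ w' → c + (neg c + w') % M ≋ w'
    back w' = ≋-trans (+-≋ (≋-refl {c}) (%-≋ (neg c + w')))
      (≋-trans (≡⇒≋ (sym (+-assoc c (neg c) w'))) (+-≋ (+-neg c) (≋-refl {w'})))

-- The neighbourhood of a vertex

-- Opens a gap of Δ new vertices just below H.
stretch : ℕ → ℕ → ℕ → ℕ
stretch H Δ x with x <? H
... | yes _ = x
... | no  _ = x + Δ

stretch-< : ∀ H Δ {x} → x < H → stretch H Δ x ≡ x
stretch-< H Δ {x} x<H with x <? H
... | yes _   = refl
... | no  x≮H = ⊥-elim (x≮H x<H)

stretch-≥ : ∀ H Δ {x} → H ≤ x → stretch H Δ x ≡ x + Δ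
stretch-≥ H Δ {x} H≤x with x <? H
... | yes x<H = ⊥-elim (<⇒≱ x<H H≤x)
... | no  _   = refl

stretch-injective : ∀ H Δ x y → stretch H Δ x ≡ stretch H Δ y → x ≡ y
stretch-injective H Δ x y e with x <? H | y <? H
... | yes _   | yes _   = e
... | no  _   | no  _   = +-cancelʳ-≡ Δ x y e
... | yes x<H | no  y≮H = ⊥-elim (y≮H (≤-<-trans (m≤m+n y Δ) (subst (_< H) e x<H)))
... | no  x≮H | yes y<H = ⊥-elim (x≮H (≤-<-trans (m≤m+n x Δ) (subst (_< H) (sym e) y<H)))

[t+m]%m≡t : ∀ m-1 {t} → t < suc m-1 → (t + suc m-1) % suc m-1 ≡ t
[t+m]%m≡t m-1 {t} t<m = trans ([m+n]%n≡m%n t (suc m-1)) (m<n⇒m%n≡m t<m)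

0∈translate⁻ : ∀ M-1 P S {w} → (∀ {s} → s ∈ P → s ≤ S) → S < suc M-1 → w < suc M-1 →
  0 ∈ translate M-1 P w → w ≡ 0 ⊎ ∃ λ p → p ∈ P × 1 ≤ p × w + p ≡ suc M-1
0∈translate⁻ M-1 P S {w} P≤S S<M w<M 0∈ with ∈-map⁻ (λ s → modN (w + s) (suc M-1)) 0∈
... | s , s∈P , 0≡ with w + s <? suc M-1
... | yes w+s<M = inj₁ (m+n≡0⇒m≡0 w (trans (sym (m<n⇒m%n≡m w+s<M)) (sym 0≡)))
... | no  w+s≮M = inj₂ (s , s∈P , 1≤s s w+s≡M , w+s≡M)
  where
  M = suc M-1
  t = w + s ∸ M
  w+s≡t+M : w + s ≡ t + M
  w+s≡t+M = sym (m∸n+n≡m (≮⇒≥ w+s≮M))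
  t<M : t < M
  t<M = +-cancelʳ-< M t M (subst (_< M + M) w+s≡t+M (+-mono-< w<M (≤-<-trans (P≤S s∈P) S<M)))
  w+s≡M : w + s ≡ M
  w+s≡M = trans w+s≡t+M (cong (_+ M) (trans (sym ([t+m]%m≡t M-1 t<M)) (trans (cong (_% M) (sym w+s≡t+M)) (sym 0≡))))
  1≤s : ∀ s → w + s ≡ M → 1 ≤ s
  1≤s zero    w+0≡M = ⊥-elim (<-irrefl (trans (sym (+-identityʳ w)) w+0≡M) w<M)
  1≤s (suc _) _     = s≤s z≤n

-- The link of 0 in a union of difference cycles with partial sums at most S only sees
-- the vertices within distance S of 0, so it is the same for all vertex counts above 2S.
module Window (S M₁-1 M₂-1 : ℕ) (2S<M₁ : suc (S + S) ≤ suc M₁-1) (M₁≤M₂ : suc M₁-1 ≤ suc M₂-1) where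

  M₁ M₂ Δ : ℕ
  M₁ = suc M₁-1
  M₂ = suc M₂-1
  Δ = M₂-1 ∸ M₁-1

  g : ℕ → ℕ
  g = stretch (suc S) Δ

  M₁+Δ≡M₂ : M₁ + Δ ≡ M₂
  M₁+Δ≡M₂ = cong suc (m+[n∸m]≡n (≤-pred M₁≤M₂))

  S<M₁ : S < M₁
  S<M₁ = <-≤-trans (s≤s (m≤m+n S S)) 2S<M₁

  S<M₂ : S < M₂
  S<M₂ = <-≤-trans S<M₁ M₁≤M₂

  g0≡0 : g 0 ≡ 0
  g0≡0 = stretch-< (suc S) Δ (s≤s z≤n)

  data Through0 (w : ℕ) : Set where
    base : w ≡ 0 → Through0 w
    wrap : ∀ p → 1 ≤ p → p ≤ S → w + p ≡ M₁ → Through0 w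

  wrap-far : ∀ {w p} → p ≤ S → w + p ≡ M₁ → suc S ≤ w
  wrap-far {w} {p} p≤S w+p≡M₁ with w <? suc S
  ... | no  w≮ = ≮⇒≥ w≮
  ... | yes w≤S = ⊥-elim (<-irrefl refl (≤-trans 2S<M₁ (subst (_≤ S + S) w+p≡M₁ (+-mono-≤ (≤-pred w≤S) p≤S))))

  g-translate : ∀ {w s} → Through0 w → s ≤ S → g ((w + s) % M₁) ≡ (g w + s) % M₂
  g-translate {s = s} (base refl) s≤S = begin
    g (s % M₁)       ≡⟨ cong g (m<n⇒m%n≡m (≤-<-trans s≤S S<M₁)) ⟩
    g s              ≡⟨ stretch-< (suc S) Δ (s≤s s≤S) ⟩
    s                ≡⟨ m<n⇒m%n≡m (≤-<-trans s≤S S<M₂) ⟨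
    s % M₂           ≡⟨ cong (λ z → (z + s) % M₂) g0≡0 ⟨
    (g 0 + s) % M₂   ∎
    where open ≡-Reasoning
  g-translate {w} {s} (wrap p _ p≤S w+p≡M₁) s≤S with s <? p
  ... | yes s<p = begin
    g ((w + s) % M₁)    ≡⟨ cong g (m<n⇒m%n≡m w+s<M₁) ⟩
    g (w + s)           ≡⟨ stretch-≥ (suc S) Δ (≤-trans S<w (m≤m+n w s)) ⟩
    w + s + Δ           ≡⟨ m<n⇒m%n≡m w+s+Δ<M₂ ⟨
    (w + s + Δ) % M₂    ≡⟨ cong (_% M₂) (+-comm-middle w s Δ) ⟩
    (w + Δ + s) % M₂    ≡⟨ cong (λ z → (z + s) % M₂) (stretch-≥ (suc S) Δ S<w) ⟨
    (g w + s) % M₂      ∎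
    where
    open ≡-Reasoning
    S<w : suc S ≤ w
    S<w = wrap-far p≤S w+p≡M₁
    w+s<M₁ : w + s < M₁
    w+s<M₁ = subst (w + s <_) w+p≡M₁ (+-monoʳ-< w s<p)
    w+s+Δ<M₂ : w + s + Δ < M₂
    w+s+Δ<M₂ = subst (w + s + Δ <_) M₁+Δ≡M₂ (+-monoˡ-< Δ w+s<M₁)
    +-comm-middle : ∀ a b c → a + b + c ≡ a + c + b
    +-comm-middle = solve-∀
  ... | no s≮p = begin
    g ((w + s) % M₁)    ≡⟨ cong (λ z → g (z % M₁)) w+s≡t+M₁ ⟩
    g ((t + M₁) % M₁)   ≡⟨ cong g ([t+m]%m≡t M₁-1 (≤-<-trans t≤S S<M₁)) ⟩
    g t                 ≡⟨ stretch-< (suc S) Δ (s≤s t≤S) ⟩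
    t                   ≡⟨ [t+m]%m≡t M₂-1 (≤-<-trans t≤S S<M₂) ⟨
    (t + M₂) % M₂       ≡⟨ cong (_% M₂) w+Δ+s≡t+M₂ ⟨
    (w + Δ + s) % M₂    ≡⟨ cong (λ z → (z + s) % M₂) (stretch-≥ (suc S) Δ (wrap-far p≤S w+p≡M₁)) ⟨
    (g w + s) % M₂      ∎
    where
    open ≡-Reasoning
    t = s ∸ p
    s≡p+t : s ≡ p + t
    s≡p+t = sym (m+[n∸m]≡n (≮⇒≥ s≮p))
    t≤S : t ≤ S
    t≤S = ≤-trans (m∸n≤m s p) s≤S
    rearrange : ∀ w Δ p t → w + Δ + (p + t) ≡ t + (w + p + Δ)
    rearrange = solve-∀
    w+s≡t+M₁ : w + s ≡ t + M₁
    w+s≡t+M₁ = subst (λ z → w + s ≡ t + z) w+p≡M₁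
      (subst (λ z → w + z ≡ t + (w + p)) (sym s≡p+t) (trans (sym (+-assoc w p t)) (+-comm (w + p) t)))
    w+Δ+s≡t+M₂ : w + Δ + s ≡ t + M₂
    w+Δ+s≡t+M₂ = trans (cong (w + Δ +_) s≡p+t)
      (trans (rearrange w Δ p t) (cong (t +_) (trans (cong (_+ Δ) w+p≡M₁) M₁+Δ≡M₂)))

  g-base-< : ∀ {w} → Through0 w → g w < M₂
  g-base-< (base refl) = subst (_< M₂) (sym g0≡0) (s≤s z≤n)
  g-base-< {w} (wrap p 1≤p p≤S w+p≡M₁) = subst (_< M₂) (sym (stretch-≥ (suc S) Δ (wrap-far p≤S w+p≡M₁)))
    (subst (w + Δ <_) M₁+Δ≡M₂ (+-monoˡ-< Δ (subst (w <_) w+p≡M₁ (m<m+n w 1≤p))))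

  g-translate-facet : ∀ P {w} → (∀ {s} → s ∈ P → s ≤ S) → Through0 w →
    map g (translate M₁-1 P w) ≡ translate M₂-1 P (g w)
  g-translate-facet P P≤S w⁰ =
    trans (sym (map-∘ P)) (map-cong-local (All.tabulate λ s∈ → g-translate w⁰ (P≤S s∈)))

  0∈-Through0 : ∀ P {w} → (∀ {s} → s ∈ P → s ≤ S) → w < M₁ → 0 ∈ translate M₁-1 P w → Through0 w
  0∈-Through0 P P≤S w<M₁ 0∈ with 0∈translate⁻ M₁-1 P S P≤S S<M₁ w<M₁ 0∈
  ... | inj₁ w≡0                     = base w≡0
  ... | inj₂ (p , p∈ , 1≤p , w+p≡M) = wrap p 1≤p (P≤S p∈) w+p≡M

  0∈-g-preimage : ∀ P {w'} → (∀ {s} → s ∈ P → s ≤ S) → w' < M₂ → 0 ∈ translate M₂-1 P w' →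
    ∃ λ w → w < M₁ × Through0 w × g w ≡ w'
  0∈-g-preimage P {w'} P≤S w'<M₂ 0∈ with 0∈translate⁻ M₂-1 P S P≤S S<M₂ w'<M₂ 0∈
  ... | inj₁ refl = 0 , s≤s z≤n , base refl , g0≡0
  ... | inj₂ (p , p∈ , 1≤p , w'+p≡M₂) = M₁ ∸ p , w<M₁ , wrap p 1≤p (P≤S p∈) w+p≡M₁ , gw≡w'
    where
    w+p≡M₁ : M₁ ∸ p + p ≡ M₁
    w+p≡M₁ = m∸n+n≡m (<⇒≤ (≤-<-trans (P≤S p∈) S<M₁))
    w<M₁ : M₁ ∸ p < M₁
    w<M₁ = subst (M₁ ∸ p <_) w+p≡M₁ (m<m+n (M₁ ∸ p) 1≤p)
    gw≡w' : g (M₁ ∸ p) ≡ w'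
    gw≡w' = +-cancelʳ-≡ p _ _ (begin
      g (M₁ ∸ p) + p      ≡⟨ cong (_+ p) (stretch-≥ (suc S) Δ (wrap-far (P≤S p∈) w+p≡M₁)) ⟩
      M₁ ∸ p + Δ + p      ≡⟨ +-assoc (M₁ ∸ p) Δ p ⟩
      M₁ ∸ p + (Δ + p)    ≡⟨ cong (M₁ ∸ p +_) (+-comm Δ p) ⟩
      M₁ ∸ p + (p + Δ)    ≡⟨ +-assoc (M₁ ∸ p) p Δ ⟨
      M₁ ∸ p + p + Δ      ≡⟨ cong (_+ Δ) w+p≡M₁ ⟩
      M₁ + Δ              ≡⟨ M₁+Δ≡M₂ ⟩
      M₂                  ≡⟨ w'+p≡M₂ ⟨
      w' + p              ∎)
      where open ≡-Reasoning

  cycles-link₀-Iso : ∀ r (g₁ g₂ P : Fin r → List ℕ) →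
    (∀ i → psums (g₁ i) ≡ P i) → (∀ i → psums (g₂ i) ≡ P i) → (∀ i {s} → s ∈ P i → s ≤ S) →
    Iso (link 0 (cycles M₁ r g₁)) (link 0 (cycles M₂ r g₂))
  cycles-link₀-Iso r g₁ g₂ P psums₁ psums₂ P≤S =
    local-bijection⇒Iso-link _ _ g g0≡0 (stretch-injective (suc S) Δ) fwd bwd
    where
    K₁ = cycles M₁ r g₁
    K₂ = cycles M₂ r g₂
    fwd : ∀ {F} → F ∈ K₁ → 0 ∈ F → map g F ∈ K₂
    fwd F∈ 0∈F with ∈-cycles⁻ M₁-1 r g₁ F∈
    ... | i , w , w<M₁ , refl rewrite psums₁ i =
      subst (_∈ K₂) (sym (g-translate-facet (P i) (P≤S i) w⁰))
        (subst (λ Q → translate M₂-1 Q (g w) ∈ K₂) (psums₂ i) (∈-cycles⁺ M₂-1 r g₂ i (g-base-< w⁰)))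
      where w⁰ = 0∈-Through0 (P i) (P≤S i) w<M₁ 0∈F
    bwd : ∀ {F'} → F' ∈ K₂ → 0 ∈ F' → ∃ λ F → F ∈ K₁ × 0 ∈ F × map g F ≡ F'
    bwd F'∈ 0∈F' with ∈-cycles⁻ M₂-1 r g₂ F'∈
    ... | i , w' , w'<M₂ , refl rewrite psums₂ i with 0∈-g-preimage (P i) (P≤S i) w'<M₂ 0∈F'
    ... | w , w<M₁ , w⁰ , refl = F , ∈-cycles⁺ M₁-1 r g₁ i w<M₁ , 0∈F , gF≡F'
      where
      F = translate M₁-1 (psums (g₁ i)) w
      gF≡F' : map g F ≡ translate M₂-1 (P i) (g w)
      gF≡F' = subst (λ Q → map g (translate M₁-1 Q w) ≡ translate M₂-1 (P i) (g w)) (sym (psums₁ i))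
                (g-translate-facet (P i) (P≤S i) w⁰)
      0∈F : 0 ∈ F
      0∈F with ∈-map⁻ g (subst (0 ∈_) (sym gF≡F') 0∈F')
      ... | x , x∈F , 0≡gx = subst (_∈ F) (stretch-injective (suc S) Δ x 0 (trans (sym 0≡gx) (sym g0≡0))) x∈F

-- Gap sequences

Strict : List ℕ → Set
Strict = Linked _<_

Strict⇒Unique : ∀ {xs} → Strict xs → Unique xs
Strict⇒Unique xs< = AllPairs.map <⇒≢ (Linked⇒AllPairs <-trans xs<)

-- junk value 0 on the empty list
head₀ : List ℕ → ℕ
head₀ []      = 0
head₀ (p ∷ _) = p

head₀-≤ : ∀ {xs} → Strict xs → ∀ {z} → z ∈ xs → head₀ xs ≤ z
head₀-≤ _    (here refl) = ≤-refl
head₀-≤ xs< (there z∈) with Linked⇒AllPairs <-trans xs<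
... | p<r ∷ _ = <⇒≤ (All.lookup p<r z∈)

sort-strict : ∀ xs → Unique xs → Strict (sort xs)
sort-strict xs xs! = sorted-unique⇒strict (sort-↗ xs) (Perm.Unique-resp-↭ (↭⇒↭ₛ (↭-sym (sort-↭ xs))) xs!)
  where
  sorted-unique⇒strict : ∀ {ys} → Linked _≤_ ys → Unique ys → Strict ys
  sorted-unique⇒strict []           _              = []
  sorted-unique⇒strict [-]          _              = [-]
  sorted-unique⇒strict (y≤z ∷ ys≤) ((y≢z ∷ _) ∷ ys!) = ≤∧≢⇒< y≤z y≢z ∷ sorted-unique⇒strict ys≤ ys!

∈-sort⁺ : ∀ {xs z} → z ∈ xs → z ∈ sort xs
∈-sort⁺ {xs} z∈ = ∈-resp-↭ (↭-sym (sort-↭ xs)) z∈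

∈-sort⁻ : ∀ {xs z} → z ∈ sort xs → z ∈ xs
∈-sort⁻ {xs} z∈ = ∈-resp-↭ (sort-↭ xs) z∈

gaps : List ℕ → ℕ → List ℕ
gaps []          T = []
gaps (p ∷ [])    T = T ∸ p ∷ []
gaps (p ∷ q ∷ r) T = q ∸ p ∷ gaps (q ∷ r) T

length-gaps : ∀ xs T → length (gaps xs T) ≡ length xs
length-gaps []          T = refl
length-gaps (p ∷ [])    T = refl
length-gaps (p ∷ q ∷ r) T = cong suc (length-gaps (q ∷ r) T)

gaps-positive : ∀ {xs} T → Strict xs → (∀ {z} → z ∈ xs → z < T) → ∀ {g} → g ∈ gaps xs T → 1 ≤ g
gaps-positive T [-]          xs<T (here refl) = m<n⇒0<n∸m (xs<T (here refl))
gaps-positive T (p<q ∷ _)    xs<T (here refl) = m<n⇒0<n∸m p<q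
gaps-positive T (p<q ∷ qr<)  xs<T (there g∈)  = gaps-positive T qr< (xs<T ∘ there) g∈

sum-gaps : ∀ {xs} T → Strict xs → xs ≢ [] → (∀ {z} → z ∈ xs → z ≤ T) → sum (gaps xs T) + head₀ xs ≡ T
sum-gaps     T []  xs≢[] _ = ⊥-elim (xs≢[] refl)
sum-gaps {p ∷ []} T [-] _ xs≤T = trans (cong (_+ p) (+-identityʳ (T ∸ p))) (m∸n+n≡m (xs≤T (here refl)))
sum-gaps {p ∷ q ∷ r} T (p<q ∷ qr<) _ xs≤T = begin
  q ∸ p + rest + p    ≡⟨ cong (_+ p) (+-comm (q ∸ p) rest) ⟩
  rest + (q ∸ p) + p  ≡⟨ +-assoc rest (q ∸ p) p ⟩
  rest + (q ∸ p + p)  ≡⟨ cong (rest +_) (m∸n+n≡m (<⇒≤ p<q)) ⟩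
  rest + q            ≡⟨ sum-gaps T qr< (λ ()) (xs≤T ∘ there) ⟩
  T                   ∎
  where
  open ≡-Reasoning
  rest = sum (gaps (q ∷ r) T)

[q∸p]+[z∸q]≡z∸p : ∀ {p q z} → p ≤ q → q ≤ z → q ∸ p + (z ∸ q) ≡ z ∸ p
[q∸p]+[z∸q]≡z∸p {p} {q} {z} p≤q q≤z = +-cancelʳ-≡ p _ _ (begin
  q ∸ p + (z ∸ q) + p   ≡⟨ cong (_+ p) (+-comm (q ∸ p) (z ∸ q)) ⟩
  z ∸ q + (q ∸ p) + p   ≡⟨ +-assoc (z ∸ q) (q ∸ p) p ⟩
  z ∸ q + (q ∸ p + p)   ≡⟨ cong (z ∸ q +_) (m∸n+n≡m p≤q) ⟩
  z ∸ q + q             ≡⟨ m∸n+n≡m q≤z ⟩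
  z                     ≡⟨ m∸n+n≡m (≤-trans p≤q q≤z) ⟨
  z ∸ p + p             ∎)
  where open ≡-Reasoning

psums-gaps : ∀ {xs} T → Strict xs → psums (gaps xs T) ≡ map (_∸ head₀ xs) xs
psums-gaps T [] = refl
psums-gaps {p ∷ []} T [-] = cong (_∷ []) (sym (n∸n≡0 p))
psums-gaps {p ∷ q ∷ r} T (p<q ∷ qr<) = cong₂ _∷_ (sym (n∸n≡0 p)) (begin
  map (q ∸ p +_) (psums (gaps (q ∷ r) T))  ≡⟨ cong (map (q ∸ p +_)) (psums-gaps T qr<) ⟩
  map (q ∸ p +_) (map (_∸ q) (q ∷ r))      ≡⟨ map-∘ (q ∷ r) ⟨
  map (λ z → q ∸ p + (z ∸ q)) (q ∷ r)      ≡⟨ map-cong-local (All.tabulate λ z∈ → [q∸p]+[z∸q]≡z∸p (<⇒≤ p<q) (head₀-≤ qr< z∈)) ⟩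
  map (_∸ p) (q ∷ r)                       ∎)
  where open ≡-Reasoning

length-psums : ∀ xs → length (psums xs) ≡ length xs
length-psums []       = refl
length-psums (x ∷ xs) = cong suc (trans (length-map (x +_) (psums xs)) (length-psums xs))

-- junk value 0 past the end
lookup₀ : List ℕ → ℕ → ℕ
lookup₀ []       _       = 0
lookup₀ (x ∷ xs) zero    = x
lookup₀ (x ∷ xs) (suc i) = lookup₀ xs i

tabulate-lookup₀ : ∀ d xs → length xs ≡ suc d → tabulate {n = suc d} (lookup₀ xs ∘ toℕ) ≡ xs
tabulate-lookup₀ zero    (x ∷ [])     _   = refl
tabulate-lookup₀ (suc d) (x ∷ y ∷ ys) len = cong (x ∷_) (tabulate-lookup₀ d (y ∷ ys) (suc-injective len))

-- The pairs (Σ_{t<j} a t, Σ_{t<j} c t), j ≤ d, whose affine combinations are the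
-- partial sums of the gaps a t + c t * k.
pairPsums : (d : ℕ) → (Fin (suc d) → ℕ) → (Fin (suc d) → ℕ) → List (ℕ × ℕ)
pairPsums zero    a c = (0 , 0) ∷ []
pairPsums (suc d) a c = (0 , 0) ∷ map (λ (A , C) → (a fzero + A , c fzero + C)) (pairPsums d (a ∘ fsuc) (c ∘ fsuc))

at : ℕ → ℕ × ℕ → ℕ
at k (A , C) = A + C * k

psums-tabulate-affine : ∀ d (a c : Fin (suc d) → ℕ) k →
  psums (tabulate (λ t → a t + c t * k)) ≡ map (at k) (pairPsums d a c)
psums-tabulate-affine zero    a c k = refl
psums-tabulate-affine (suc d) a c k = cong (0 ∷_) (begin
  map (a₀ + c₀ * k +_) (psums (tabulate (λ t → a (fsuc t) + c (fsuc t) * k)))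
    ≡⟨ cong (map (a₀ + c₀ * k +_)) (psums-tabulate-affine d (a ∘ fsuc) (c ∘ fsuc) k) ⟩
  map (a₀ + c₀ * k +_) (map (at k) ps)
    ≡⟨ map-∘ ps ⟨
  map (λ p → a₀ + c₀ * k + at k p) ps
    ≡⟨ map-cong (λ (A , C) → regroup a₀ c₀ k A C) ps ⟩
  map (λ p → at k (a₀ + proj₁ p , c₀ + proj₂ p)) ps
    ≡⟨ map-∘ ps ⟩
  map (at k) (map (λ (A , C) → (a₀ + A , c₀ + C)) ps) ∎)
  where
  open ≡-Reasoning
  a₀ = a fzero
  c₀ = c fzero
  ps = pairPsums d (a ∘ fsuc) (c ∘ fsuc)
  regroup : ∀ a₀ c₀ k A C → a₀ + c₀ * k + (A + C * k) ≡ a₀ + A + (c₀ + C) * k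
  regroup = solve-∀

pairPsums-≤ : ∀ d (a c : Fin (suc d) → ℕ) {p} → p ∈ pairPsums d a c →
  proj₁ p ≤ sum (tabulate a) × proj₂ p ≤ sum (tabulate c)
pairPsums-≤ zero    a c (here refl) = z≤n , z≤n
pairPsums-≤ (suc d) a c (here refl) = z≤n , z≤n
pairPsums-≤ (suc d) a c (there p∈) with ∈-map⁻ (λ (A , C) → (a fzero + A , c fzero + C)) p∈
... | _ , p'∈ , refl = let A≤ , C≤ = pairPsums-≤ d (a ∘ fsuc) (c ∘ fsuc) p'∈
                       in +-monoʳ-≤ (a fzero) A≤ , +-monoʳ-≤ (c fzero) C≤

length-pairPsums : ∀ d (a c : Fin (suc d) → ℕ) → length (pairPsums d a c) ≡ suc d
length-pairPsums zero    a c = refl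
length-pairPsums (suc d) a c =
  cong suc (trans (length-map _ (pairPsums d (a ∘ fsuc) (c ∘ fsuc))) (length-pairPsums d (a ∘ fsuc) (c ∘ fsuc)))

lastIndicator : (d : ℕ) → Fin (suc d) → ℕ
lastIndicator d t = if toℕ t ≡ᵇ d then 1 else 0

-- The last gap does not enter the partial sums.
psums-+lastIndicator : ∀ d (h : Fin (suc d) → ℕ) j →
  psums (tabulate (λ t → h t + lastIndicator d t * j)) ≡ psums (tabulate h)
psums-+lastIndicator zero    h j = refl
psums-+lastIndicator (suc d) h j =
  cong (0 ∷_) (cong₂ (λ x ys → map (x +_) ys) (+-identityʳ (h fzero)) (psums-+lastIndicator d (h ∘ fsuc) j))

sum-lastIndicator : ∀ d → sum (tabulate (lastIndicator d)) ≡ 1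
sum-lastIndicator zero    = refl
sum-lastIndicator (suc d) = sum-lastIndicator d

-- Rescaling by l

-- Stated with l = C + D, so that no truncated subtraction occurs.
[C+D]-identity : ∀ C D v A k n →
  (C + D) * (v + (A + C * k)) + D * (n + (C + D) * k) ≡ (C + D) * v + (C + D) * (C + D) * k + ((C + D) * A + D * n)
[C+D]-identity = solve-∀

module Relabelling (d l n-1 m : ℕ) (a lc : Fin m → Fin (suc d) → ℕ)
  (sum-a : ∀ i → sum (tabulate (a i)) ≡ suc n-1) (sum-lc : ∀ i → sum (tabulate (lc i)) ≡ l)
  {x₀ y₀ : ℕ} (l*x₀≡1 : l * x₀ ≡ 1 + y₀ * suc n-1)
  where

  n : ℕ
  n = suc n-1

  partials : Fin m → List (ℕ × ℕ)
  partials i = pairPsums d (a i) (lc i)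

  -- Multiplying by l turns the partial sum A + C k into l A + (l - C) n modulo n + l k.
  offset : ℕ × ℕ → ℕ
  offset (A , C) = l * A + (l ∸ C) * n

  offsets : Fin m → List ℕ
  offsets i = map offset (partials i)

  S : ℕ
  S = l * n + l * n

  partials-≤ : ∀ i {p} → p ∈ partials i → proj₁ p ≤ n × proj₂ p ≤ l
  partials-≤ i {p} p∈ = let A≤ , C≤ = pairPsums-≤ d (a i) (lc i) p∈ in
    subst (proj₁ p ≤_) (sum-a i) A≤ , subst (proj₂ p ≤_) (sum-lc i) C≤

  offset-≤ : ∀ i {p} → p ∈ partials i → offset p ≤ S
  offset-≤ i {p} p∈ = +-mono-≤ (*-monoʳ-≤ l (proj₁ (partials-≤ i p∈))) (*-monoˡ-≤ n (m∸n≤m l (proj₂ p)))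

  Ngaps : ℕ → Fin m → List ℕ
  Ngaps k i = tabulate (λ t → a i t + lc i t * k)

  module AtStep (k : ℕ) where

    M-1 : ℕ
    M-1 = n-1 + l * k
    open Modulo M-1 public

    x : ℕ
    x = x₀ + y₀ * k

    l*x≡1 : l * x ≡ 1 + y₀ * M
    l*x≡1 = begin
      l * (x₀ + y₀ * k)              ≡⟨ expand l x₀ y₀ k ⟩
      l * x₀ + y₀ * (l * k)          ≡⟨ cong (_+ y₀ * (l * k)) l*x₀≡1 ⟩
      1 + y₀ * n + y₀ * (l * k)      ≡⟨ collect y₀ n (l * k) ⟩
      1 + y₀ * M                     ∎
      where
      open ≡-Reasoning
      expand : ∀ l x₀ y₀ k → l * (x₀ + y₀ * k) ≡ l * x₀ + y₀ * (l * k)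
      expand = solve-∀
      collect : ∀ y₀ n lk → 1 + y₀ * n + y₀ * lk ≡ 1 + y₀ * (n + lk)
      collect = solve-∀

    open Unit {l} {x} {y₀} l*x≡1 public

    scale : ℕ → ℕ
    scale v = (l * v) % M

    base : ℕ → ℕ
    base v = l * v + l * l * k

    scale-partial : ∀ i v {p} → p ∈ partials i → scale ((v + at k p) % M) ≡ (base v + offset p) % M
    scale-partial i v {A , C} p∈ = un (≋-trans (*-≋ (≋-refl {l}) (%-≋ (v + at k (A , C))))
      (≋-trans (≋-sym (+kM-≋ _ (l ∸ C))) (≡⇒≋ identity)))
      where
      identity : l * (v + (A + C * k)) + (l ∸ C) * M ≡ base v + offset (A , C)
      identity = subst (λ L → L * (v + (A + C * k)) + (l ∸ C) * (n + L * k) ≡ L * v + L * L * k + (L * A + (l ∸ C) * n))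
                   (m+[n∸m]≡n (proj₂ (partials-≤ i p∈))) ([C+D]-identity C (l ∸ C) v A k n)

    scale-translate : ∀ i v → map scale (translate M-1 (psums (Ngaps k i)) v) ≡ map (λ z → (base v + z) % M) (offsets i)
    scale-translate i v = begin
      map scale (map (λ s → (v + s) % M) (psums (Ngaps k i)))
        ≡⟨ cong (λ Q → map scale (map (λ s → (v + s) % M) Q)) (psums-tabulate-affine d (a i) (lc i) k) ⟩
      map scale (map (λ s → (v + s) % M) (map (at k) (partials i)))
        ≡⟨ cong (map scale) (map-∘ (partials i)) ⟨
      map scale (map (λ p → (v + at k p) % M) (partials i))
        ≡⟨ map-∘ (partials i) ⟨
      map (λ p → scale ((v + at k p) % M)) (partials i)
        ≡⟨ map-cong-local (All.tabulate (scale-partial i v)) ⟩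
      map (λ p → (base v + offset p) % M) (partials i)
        ≡⟨ map-∘ (partials i) ⟩
      map (λ z → (base v + z) % M) (offsets i) ∎
      where open ≡-Reasoning

  offsets-unique : CombManifold d (series d n l m a lc 0) → ∀ i → Unique (offsets i)
  offsets-unique ((_ , facets) , _) i =
    Unique-map⁻ (subst Unique (scale-translate i 0)
      (Unique-map⁺-local scale (λ x∈ y∈ → *-injective (translate-< M-1 (psums (Ngaps 0 i)) 0 x∈) (translate-< M-1 (psums (Ngaps 0 i)) 0 y∈))
        (proj₁ (All.lookup facets (∈-cycles⁺ M-1 m (Ngaps 0) i (s≤s z≤n))))))
    where open AtStep 0

  module Dense (1≤l : 1 ≤ l) (i₀ : Fin m) (N-mfd : ∀ k → CombManifold d (series d n l m a lc k)) where

    offsets! : ∀ i → Unique (offsets i)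
    offsets! = offsets-unique (N-mfd 0)

    Z : Fin m → List ℕ
    Z i = sort (offsets i)

    Z-strict : ∀ i → Strict (Z i)
    Z-strict i = sort-strict (offsets i) (offsets! i)

    Z-≤ : ∀ i {z} → z ∈ Z i → z ≤ S
    Z-≤ i z∈ with ∈-map⁻ offset (∈-sort⁻ z∈)
    ... | p , p∈ , refl = offset-≤ i p∈

    length-Z : ∀ i → length (Z i) ≡ suc d
    length-Z i = trans (↭-length (sort-↭ (offsets i)))
                   (trans (length-map offset (partials i)) (length-pairPsums d (a i) (lc i)))

    z₀ : Fin m → ℕ
    z₀ i = head₀ (Z i)

    N₀ : ℕ
    N₀ = S + S

    -- The closing gap makes each cycle span suc N₀ vertices.
    top : Fin m → ℕ
    top i = suc N₀ + z₀ i

    Z-<top : ∀ i {z} → z ∈ Z i → z < top i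
    Z-<top i z∈ = ≤-<-trans (Z-≤ i z∈) (≤-trans (s≤s (m≤m+n S S)) (m≤m+n (suc N₀) (z₀ i)))

    b : Fin m → Fin (suc d) → ℕ
    b i = lookup₀ (gaps (Z i) (top i)) ∘ toℕ

    e : Fin m → Fin (suc d) → ℕ
    e i = lastIndicator d

    tabulate-b : ∀ i → tabulate (b i) ≡ gaps (Z i) (top i)
    tabulate-b i = tabulate-lookup₀ d (gaps (Z i) (top i)) (trans (length-gaps (Z i) (top i)) (length-Z i))

    b-positive : ∀ i t → 1 ≤ b i t
    b-positive i t = gaps-positive (top i) (Z-strict i) (Z-<top i) (subst (b i t ∈_) (tabulate-b i) (∈-tabulate⁺ {f = b i} t))

    sum-b : ∀ i → sum (tabulate (b i)) ≡ suc N₀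
    sum-b i = trans (cong sum (tabulate-b i)) (+-cancelʳ-≡ (z₀ i) _ _
      (sum-gaps (top i) (Z-strict i) Z≢[] (<⇒≤ ∘ Z-<top i)))
      where
      Z≢[] : Z i ≢ []
      Z≢[] Z≡[] = 0≢1+n (trans (cong length (sym Z≡[])) (length-Z i))

    Dgaps : ℕ → Fin m → List ℕ
    Dgaps j i = tabulate (λ t → b i t + e i t * j)

    P : Fin m → List ℕ
    P i = map (_∸ z₀ i) (Z i)

    psums-Dgaps : ∀ j i → psums (Dgaps j i) ≡ P i
    psums-Dgaps j i = trans (psums-+lastIndicator d (b i) j)
                        (trans (cong psums (tabulate-b i)) (psums-gaps (top i) (Z-strict i)))

    P-≤ : ∀ i {s} → s ∈ P i → s ≤ S
    P-≤ i s∈ with ∈-map⁻ (_∸ z₀ i) s∈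
    ... | z , z∈ , refl = ≤-trans (m∸n≤m z (z₀ i)) (Z-≤ i z∈)

    P-unique : ∀ i → Unique (P i)
    P-unique i = Unique-map⁺-local (_∸ z₀ i)
      (λ x∈ y∈ x∸≡y∸ → trans (sym (m∸n+n≡m (z₀-≤ x∈))) (trans (cong (_+ z₀ i) x∸≡y∸) (m∸n+n≡m (z₀-≤ y∈))))
      (Strict⇒Unique (Z-strict i))
      where
      z₀-≤ : ∀ {z} → z ∈ Z i → z₀ i ≤ z
      z₀-≤ = head₀-≤ (Z-strict i)

    -- Rescaling by l identifies N_k with the cycles of gaps Dgaps j on n + l k vertices,
    -- for every j: the value of j only matters through the number of vertices.
    series-Iso-cycles : ∀ k j → Iso (series d n l m a lc k) (cycles (suc (AtStep.M-1 k)) m (Dgaps j))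
    series-Iso-cycles k j = cycles-Iso M-1 M-1 m (Ngaps k) (Dgaps j) scale φ *-injective
      (λ i {v} _ → m%n<n (base v + z₀ i) M) fwd bwd surj
      where
      open AtStep k
      φ : Fin m → ℕ → ℕ
      φ i v = (base v + z₀ i) % M
      D-translate : ∀ i v → translate M-1 (psums (Dgaps j i)) (φ i v) ≡ map (λ z → (base v + z) % M) (Z i)
      D-translate i v = trans (cong (λ Q → translate M-1 Q (φ i v)) (psums-Dgaps j i))
        (trans (sym (map-∘ (Z i))) (map-cong-local (All.tabulate λ {z} z∈ →
          un (≋-trans (+-≋ (%-≋ (base v + z₀ i)) (≋-refl {z ∸ z₀ i}))
             (≡⇒≋ (trans (+-assoc (base v) (z₀ i) (z ∸ z₀ i)) (cong (base v +_) (m+[n∸m]≡n (head₀-≤ (Z-strict i) z∈)))))))))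
      fwd : ∀ i {v} → v < M → map scale (translate M-1 (psums (Ngaps k i)) v) ⊆ translate M-1 (psums (Dgaps j i)) (φ i v)
      fwd i {v} _ y y∈ with ∈-map⁻ (λ z → (base v + z) % M) (subst (y ∈_) (scale-translate i v) y∈)
      ... | z , z∈ , refl = subst ((base v + z) % M ∈_) (sym (D-translate i v)) (∈-map⁺ (λ z → (base v + z) % M) (∈-sort⁺ z∈))
      bwd : ∀ i {v} → v < M → translate M-1 (psums (Dgaps j i)) (φ i v) ⊆ map scale (translate M-1 (psums (Ngaps k i)) v)
      bwd i {v} _ y y∈ with ∈-map⁻ (λ z → (base v + z) % M) (subst (y ∈_) (D-translate i v) y∈)
      ... | z , z∈ , refl = subst ((base v + z) % M ∈_) (sym (scale-translate i v)) (∈-map⁺ (λ z → (base v + z) % M) (∈-sort⁻ z∈))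
      surj : ∀ i {w'} → w' < M → ∃ λ v → v < M × φ i v ≡ w'
      surj i {w'} w'<M = (x * R) % M , m%n<n (x * R) M , ≋⇒% w'<M φv≋w'
        where
        c = l * l * k + z₀ i
        R = w' + neg c
        regroup : ∀ w c' a b → w + c' + a + b ≡ w + ((a + b) + c')
        regroup = solve-∀
        φv≋w' : base ((x * R) % M) + z₀ i ≋ w'
        φv≋w' = ≋-trans (+-≋ (+-≋ (≋-trans (*-≋ (≋-refl {l}) (%-≋ (x * R))) (*-inverseʳ R)) (≋-refl {l * l * k})) (≋-refl {z₀ i}))
          (≋-trans (≡⇒≋ (regroup w' (neg c) (l * l * k) (z₀ i)))
          (≋-trans (+-≋ (≋-refl {w'}) (+-neg c)) (≡⇒≋ (+-identityʳ w'))))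

    k≤n+l*k : ∀ k → k ≤ n + l * k
    k≤n+l*k k = ≤-trans (subst (_≤ l * k) (*-identityˡ k) (*-monoˡ-≤ k 1≤l)) (m≤n+m (l * k) n)

    Dcycles-nonempty : ∀ j M-1 → cycles (suc M-1) m (Dgaps j) ≢ []
    Dcycles-nonempty j M-1 K≡[] with subst (translate M-1 (psums (Dgaps j i₀)) 0 ∈_) K≡[] (∈-cycles⁺ M-1 m (Dgaps j) i₀ (s≤s z≤n))
    ... | ()

    Dcycles-Pure : ∀ j M-1 → N₀ ≤ M-1 → Pure d (cycles (suc M-1) m (Dgaps j))
    Dcycles-Pure j M-1 N₀≤M-1 = Dcycles-nonempty j M-1 , All.tabulate facet
      where
      open Modulo M-1
      facet : ∀ {F} → F ∈ cycles M m (Dgaps j) → Unique F × length F ≡ suc d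
      facet F∈ with ∈-cycles⁻ M-1 m (Dgaps j) F∈
      ... | i , w , _ , refl = F! , length-F
        where
        P-< : ∀ {s} → s ∈ P i → s < M
        P-< s∈ = ≤-<-trans (P-≤ i s∈) (s≤s (≤-trans (m≤m+n S S) N₀≤M-1))
        F! : Unique (translate M-1 (psums (Dgaps j i)) w)
        F! = subst (λ Q → Unique (translate M-1 Q w)) (sym (psums-Dgaps j i))
               (Unique-map⁺-local _ (λ x∈ y∈ → translate-injective w (P-< x∈) (P-< y∈)) (P-unique i))
        length-F : length (translate M-1 (psums (Dgaps j i)) w) ≡ suc d
        length-F = trans (length-map _ (psums (Dgaps j i)))
                     (trans (length-psums (Dgaps j i)) (length-tabulate (λ t → b i t + e i t * j)))

    -- By rotation every vertex link is that of 0, which by the window lemma is the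
    -- link of 0 in a larger complex of the same shape: one isomorphic to some N_k.
    Dcycles-CombManifold : ∀ j M-1 → N₀ ≤ M-1 → CombManifold d (cycles (suc M-1) m (Dgaps j))
    Dcycles-CombManifold j M-1 N₀≤M-1 = Dcycles-Pure j M-1 N₀≤M-1 , links
      where
      K : Complex
      K = cycles (suc M-1) m (Dgaps j)
      k M₂-1 : ℕ
      k = suc M-1
      M₂-1 = AtStep.M-1 k
      M≤M₂ : suc M-1 ≤ suc M₂-1
      M≤M₂ = k≤n+l*k k
      K₂ = cycles (suc M₂-1) m (Dgaps 0)
      K₂≅N : Iso K₂ (series d n l m a lc k)
      K₂≅N = Iso-sym _ _ (series-Iso-cycles k 0)
      0∈K₂ : Vert 0 K₂
      0∈K₂ = lose (∈-cycles⁺ M₂-1 m (Dgaps 0) i₀ (s≤s z≤n)) (here (sym (m<n⇒m%n≡m {n = suc M₂-1} (s≤s z≤n))))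
      links : ∀ v → Vert v K → PLHomeo (link v K) (bdSimplex d)
      links v v∈K = PLHomeo.trans (PLHomeo.iso link-v≅link-0)
                      (PLHomeo.trans (PLHomeo.iso (Window.cycles-link₀-Iso S M-1 M₂-1 (s≤s N₀≤M-1) M≤M₂ m (Dgaps j) (Dgaps 0) P (psums-Dgaps j) (psums-Dgaps 0) P-≤))
                      (PLHomeo.trans (PLHomeo.iso (Iso-link _ _ K₂≅N 0∈K₂))
                      (proj₂ (N-mfd k) _ (Iso-vert _ _ K₂≅N 0∈K₂))))
        where
        open Rotation M-1
        link-v≅link-0 : Iso (link v K) (link 0 K)
        link-v≅link-0 = subst (λ u → Iso (link v K) (link u K)) (rotate-neg v)
                          (Iso-link K K (cycles-rotate-Iso m (Dgaps j) (Modulo.neg M-1 v)) v∈K)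

    dense : DenseSeries d
    dense = record
      { n' = suc N₀ ; r = m ; b = b ; e = e
      ; bpos = b-positive ; bsum = sum-b ; esum = λ _ → sum-lastIndicator d
      ; mfd = λ j → Dcycles-CombManifold j (N₀ + 1 * j) (m≤m+n N₀ (1 * j)) }

    series-ContainedInDense : ∀ k → suc N₀ ≤ n + l * k → ContainedInDense d (series d n l m a lc k)
    series-ContainedInDense k N₀<M =
      dense , j , subst (λ X → Iso (series d n l m a lc k) (cycles (suc X) m (Dgaps j))) N₀+j≡M-1 (series-Iso-cycles k j)
      where
      j = n + l * k ∸ suc N₀
      N₀+j≡M-1 : AtStep.M-1 k ≡ N₀ + 1 * j
      N₀+j≡M-1 = suc-injective (sym (trans (cong (suc N₀ +_) (*-identityˡ j)) (m+[n∸m]≡n N₀<M)))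

lemma3p8 : (d l n m : ℕ) → 1 ≤ l → l ≤ d →
    (a : Fin m → Fin (suc d) → ℕ) → (lc : Fin m → Fin (suc d) → ℕ) →
    (∀ i j → 1 ≤ a i j) → (∀ i → sum (tabulate (a i)) ≡ n) →
    (∀ i → sum (tabulate (lc i)) ≡ l) →
    (∀ k → CombManifold d (series d n l m a lc k)) →
    UnitMod l n →
    ∃ λ K₀ → ∀ k → K₀ ≤ k → ContainedInDense d (series d n l m a lc k)
lemma3p8 d l n zero _ _ a lc _ _ _ N-mfd _ = ⊥-elim (proj₁ (proj₁ (N-mfd 0)) refl)
lemma3p8 d l zero (suc _) _ _ a lc a≥1 sum-a _ _ _ =
  ⊥-elim (1+n≰n (subst (1 ≤_) (sum-a fzero) (≤-trans (a≥1 fzero fzero) (m≤m+n (a fzero fzero) _))))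
lemma3p8 d l (suc n-1) (suc m-1) 1≤l _ a lc _ sum-a sum-lc N-mfd (x , y , l*x≡1) =
  suc N₀ , λ k N₀<k → series-ContainedInDense k (≤-trans N₀<k (k≤n+l*k k))
  where
  open Relabelling d l n-1 (suc m-1) a lc sum-a sum-lc {x} {y} l*x≡1
  open Dense 1≤l fzero N-mfd
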